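{- Let $q$ be an odd prime, let $H$ be the parity-check matrix of a proper array code (PAC) with modulus $q$ consisting of three block-rows, and let $A$ be the $3q\times mq$ matrix obtained by deleting some $q-m$ block-columns from $H$. Then the shortened array code with parity-check matrix $A$ has girth at least eight if and only if the sequence of labels of the block-columns in $A$ is a non-averaging sequence over $\mathbb{Z}_q$.
   Context: For integers $a\le b$, $[a,b]=\{x\in\mathbb{Z}: a\le x\le b\}$. Let $q$ be an odd prime, $I$ the $q\times q$ identity matrix and $P\ne I$ a $q\times q$ circulant permutation matrix. Given $r\in[1,q]$ and distinct integers $a_0,\dots,a_{r-1}\in[0,q-1]$, the array code with modulus $q$ has parity-check matrix $H$ formed by an $r\times q$ array of $q\times q$ blocks, the block in block-row $i\in[0,r-1]$ and block-column $j\in[0,q-1]$ being $P^{a_i\cdot j}$; it is a proper array code (PAC) if $a_0,\dots,a_{r-1}$ is an arithmetic progression with nonzero common difference. The label of a block-column is its index $j$ in $H$; after deleting block-columns, the retained block-columns keep their labels. The girth of a code is the length of a shortest cycle in its Tanner graph (the bipartite graph with a vertex for each column and each row of the parity-check matrix, column and row vertices adjacent iff the corresponding entry is $1$). A sequence $n_1,n_2,\dots$ of distinct integers in $[0,N-1]$ is non-averaging over $\mathbb{Z}_N$ if $n_i+n_j\equiv 2n_k \pmod N$ implies $i=j=k$. -}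

module Defs where

open import Data.Nat using (ℕ; zero; suc; _<_; _≤_; _+_)
open import Data.Integer as ℤ using (ℤ; +_; _-_; _*_)
open import Data.Integer.Divisibility using (_∣_)
open import Data.Fin using (Fin; zero; suc; inject₁; fromℕ; toℕ)
open import Data.Product using (_×_; Σ)
open import Data.Sum using (_⊎_; inj₁; inj₂)
open import Relation.Binary.PropositionalEquality using (_≡_; _≢_)
open import Function.Definitions using (Injective)

infix 2 _≡_[mod_]
_≡_[mod_] : ℤ → ℤ → ℕ → Set
x ≡ y [mod N ] = (+ N) ∣ (x - y)

-- Entry (u , v) of the q×q matrix P^e, where P is the circulant permutation
-- matrix with P[u][v] = 1 iff v ≡ u + s (mod q) (s ∈ [0,q-1]; P ≠ I iff s ≠ 0).
CPMPowEntry : (q s e : ℕ) → Fin q → Fin q → Set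
CPMPowEntry q s e u v = (+ toℕ v) ≡ (+ toℕ u) ℤ.+ (+ s) * (+ e) [mod q ]

IsPAC : (q r : ℕ) → (Fin r → ℕ) → Set
IsPAC q r a =
  (∀ i → a i < q) × Injective _≡_ _≡_ a ×
  Σ ℕ (λ a₀ → Σ ℤ (λ d → d ≢ + 0 × (∀ (i : Fin r) → (+ a i) ≡ (+ a₀) ℤ.+ (+ toℕ i) * d)))

-- Shortened array code: parity-check matrix A whose block-rows are indexed by
-- i : Fin r (exponent a i) and whose m retained block-columns carry the labels
-- lab k.
AEntry : (q s r : ℕ) (a : Fin r → ℕ) (m : ℕ) (lab : Fin m → ℕ) →
         (Fin r × Fin q) → (Fin m × Fin q) → Set
AEntry q s r a m lab (i Data.Product., u) (k Data.Product., v) =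
  CPMPowEntry q s (a i Data.Nat.* lab k) u v

TannerVertex : Set → Set → Set
TannerVertex R C = C ⊎ R

TannerAdj : {R C : Set} → (R → C → Set) → TannerVertex R C → TannerVertex R C → Set
TannerAdj M (inj₁ c) (inj₁ c') = Data.Empty.⊥ where import Data.Empty
TannerAdj M (inj₁ c) (inj₂ r) = M r c
TannerAdj M (inj₂ r) (inj₁ c) = M r c
TannerAdj M (inj₂ r) (inj₂ r') = Data.Empty.⊥ where import Data.Empty

IsCycle : {V : Set} → (V → V → Set) → (k : ℕ) → (Fin (3 + k) → V) → Set
IsCycle Adj k f =
  Injective _≡_ _≡_ f ×
  (∀ (i : Fin (2 + k)) → Adj (f (inject₁ i)) (f (suc i))) ×
  Adj (f (fromℕ (2 + k))) (f zero)

GirthAtLeast : {V : Set} → (V → V → Set) → ℕ → Set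
GirthAtLeast Adj g = ∀ (k : ℕ) (f : Fin (3 + k) → _) → IsCycle Adj k f → g ≤ 3 + k

NonAveraging : (N m : ℕ) → (Fin m → ℕ) → Set
NonAveraging N m n =
  Injective _≡_ _≡_ n × (∀ i → n i < N) ×
  (∀ i j k → (+ n i) ℤ.+ (+ n j) ≡ (+ 2) * (+ n k) [mod N ] → i ≡ j × j ≡ k)

{-# OPTIONS --safe #-}
module Submission where

open import Defs
open import Data.Nat using (ℕ; _<_; _≤_)
open import Data.Nat.Divisibility using (_∣_)
open import Data.Nat.Primality using (Prime; euclidsLemma; prime⇒nonZero; ¬prime[0]; ¬prime[1])
open import Data.Fin using (Fin; toℕ; zero; suc; inject₁; fromℕ; fromℕ<; remQuot; combine)
open import Relation.Nullary using (¬_; yes; no; contradiction)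
open import Function.Bundles using (_⇔_; mk⇔; module Equivalence)

import Data.Nat as ℕ
import Data.Nat.Properties as ℕP
import Data.Nat.Divisibility as ℕD
open import Data.Fin.Patterns using (0F; 1F; 2F; 3F; 4F)
import Data.Fin.Properties as FinP
open import Data.Vec using (_∷_; []; lookup)
open import Data.Integer using (ℤ; +_; -_; _+_; _-_; _*_; ∣_∣)
import Data.Integer.Properties as ℤP
import Data.Integer.Divisibility.Signed as ℤ∣
open import Data.Integer.Divisibility.Signed using () renaming (_∣_ to _∣ℤ_)
open import Data.Integer.DivMod using (_%ℕ_; _/ℕ_; n%ℕd<d; a≡a%ℕn+[a/ℕn]*n)
open import Data.Integer.Tactic.RingSolver using (solve-∀)
open import Data.Parity using (Parity; 0ℙ; 1ℙ; _⁻¹) renaming (_+_ to _+ℙ_)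
import Data.Parity.Properties as ParityP
open import Data.Product using (_×_; _,_; Σ; proj₁; uncurry)
open import Data.Sum using (_⊎_; inj₁; inj₂; fromInj₂)
import Data.Sum as Sum
open import Data.Sum.Properties using (inj₁-injective; inj₂-injective)
open import Data.Empty using (⊥-elim)
open import Relation.Nullary.Decidable using (from-no)
open import Relation.Binary.Definitions using (tri<; tri≈; tri>)
open import Relation.Binary.PropositionalEquality
open import Function.Base using (_∘_)
open import Function.Definitions using (Injective)
open import Function.Consequences using (contraInjective)

-- An entry 1 of block (i , k) in position (u , v) says v ≡ u + s·aᵢ·ℓₖ (mod q), where ℓₖ is the
-- label of block-column k.  The Tanner graph is bipartite, so its cycles are even, and summing
-- these congruences with alternating signs around a cycle eliminates u and v.  Around a 4-cycle
-- this leaves q ∣ s(aᵢ − aᵢ′)(ℓₖ − ℓₖ′), impossible for a prime q because two distinct rows of one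
-- block-row (columns of one block-column) never share a neighbour.  A path of five edges through
-- block-rows i₁ i₂ i₃ and block-columns k₁ k₂ k₃ closes to a 6-cycle exactly when
-- q ∣ s·Σⱼ a_{iⱼ}(ℓ_{kⱼ₊₁} − ℓ_{kⱼ}).  For a proper array code aᵢ = a₀ + i·d, and the block-rows
-- of a 6-cycle are 0, 1, 2 in some order, so the sum is ±s·d·(ℓₓ + ℓᵧ − 2ℓ_z) for the block-columns
-- x, y, z in a suitable order: 6-cycles are exactly the averaging triples of labels.

multiple-below⇒0 : ∀ {n x} → n ∣ x → x < n → x ≡ 0
multiple-below⇒0 {x = ℕ.zero}  _   _   = refl
multiple-below⇒0 {x = ℕ.suc _} n∣x x<n = contradiction n∣x (ℕD.>⇒∤ x<n)

∣[+m-+n]⇒m≡n : ∀ {n i j} → i < n → j < n → + n ∣ℤ + i - + j → i ≡ j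
∣[+m-+n]⇒m≡n {n} {i} {j} i<n j<n n∣i-j =
  ℤP.+-injective (ℤP.i-j≡0⇒i≡j (+ i) (+ j) (ℤP.∣i∣≡0⇒i≡0 (multiple-below⇒0 (ℤ∣.∣⇒∣ᵤ n∣i-j) distance<n)))
  where
  distance<n : ∣ + i - + j ∣ < n
  distance<n = subst (_< n) (cong ∣_∣ (sym (ℤP.[+m]-[+n]≡m⊖n i j)))
    (ℕP.≤-<-trans (ℤP.∣m⊝n∣≤m⊔n i j) (ℕP.⊔-lub i<n j<n))

∣[i-j]⇒i≡j : ∀ {n} {i j : Fin n} → + n ∣ℤ + toℕ i - + toℕ j → i ≡ j
∣[i-j]⇒i≡j {i = i} {j} = FinP.toℕ-injective ∘ ∣[+m-+n]⇒m≡n (FinP.toℕ<n i) (FinP.toℕ<n j)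

0<n<p⇒p∤n : ∀ {p n} → 0 < n → n < p → ¬ + p ∣ℤ + n
0<n<p⇒p∤n {n = ℕ.suc _} _ n<p p∣n = ℕD.>⇒∤ n<p (ℤ∣.∣⇒∣ᵤ p∣n)

odd-prime⇒2<p : ∀ {p} → Prime p → ¬ (2 ∣ p) → 2 < p
odd-prime⇒2<p {0} 0-prime _ = contradiction 0-prime ¬prime[0]
odd-prime⇒2<p {1} 1-prime _ = contradiction 1-prime ¬prime[1]
odd-prime⇒2<p {2} _ 2∤2 = contradiction ℕD.∣-refl 2∤2
odd-prime⇒2<p {ℕ.suc (ℕ.suc (ℕ.suc _))} _ _ = ℕ.s≤s (ℕ.s≤s (ℕ.s≤s ℕ.z≤n))

∣-neg : ∀ {n x} → + n ∣ℤ - x → + n ∣ℤ x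
∣-neg {x = x} = subst (_ ∣ℤ_) (ℤP.neg-involutive x) ∘ ℤ∣.∣m⇒∣-m

prime-∣-* : ∀ {p} x y → Prime p → + p ∣ℤ x * y → + p ∣ℤ x ⊎ + p ∣ℤ y
prime-∣-* x y p-prime p∣xy = Sum.map ℤ∣.∣ᵤ⇒∣ ℤ∣.∣ᵤ⇒∣
  (euclidsLemma ∣ x ∣ ∣ y ∣ p-prime (subst (_ ∣_) (ℤP.abs-* x y) (ℤ∣.∣⇒∣ᵤ p∣xy)))

prime-∣-cancelˡ : ∀ {p} x y → Prime p → ¬ + p ∣ℤ x → + p ∣ℤ x * y → + p ∣ℤ y
prime-∣-cancelˡ x y p-prime p∤x = fromInj₂ (λ p∣x → contradiction p∣x p∤x) ∘ prime-∣-* x y p-prime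

reduce : ∀ {n} .{{_ : ℕ.NonZero n}} → ℤ → Fin n
reduce {n} x = fromℕ< (n%ℕd<d x n)

reduce-∣ : ∀ {n} .{{_ : ℕ.NonZero n}} x → + n ∣ℤ + toℕ (reduce {n} x) - x
reduce-∣ {n} x = ℤ∣.divides (- (x /ℕ n)) (begin
  + toℕ (reduce x) - x                         ≡⟨ cong (λ r → + r - x) (FinP.toℕ-fromℕ< (n%ℕd<d x n)) ⟩
  + (x %ℕ n) - x                               ≡⟨ cong (λ y → + (x %ℕ n) - y) (a≡a%ℕn+[a/ℕn]*n x n) ⟩
  + (x %ℕ n) - (+ (x %ℕ n) + (x /ℕ n) * + n)   ≡⟨ identity (+ (x %ℕ n)) (x /ℕ n) (+ n) ⟩
  - (x /ℕ n) * + n                             ∎)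
  where
  open ≡-Reasoning
  identity : ∀ r t n → r - (r + t * n) ≡ - t * n
  identity = solve-∀

increasing⇒injective : ∀ {m} {f : Fin m → ℕ} → (∀ k k′ → toℕ k < toℕ k′ → f k < f k′) →
                       Injective _≡_ _≡_ f
increasing⇒injective {f = f} increasing {k} {k′} fk≡fk′ with ℕP.<-cmp (toℕ k) (toℕ k′)
... | tri< k<k′ _ _ = contradiction fk≡fk′ (ℕP.<⇒≢ (increasing k k′ k<k′))
... | tri≈ _ k≡k′ _ = FinP.toℕ-injective k≡k′
... | tri> _ _ k′<k = contradiction (sym fk≡fk′) (ℕP.<⇒≢ (increasing k′ k k′<k))

triple-injective : ∀ {A : Set} {x y z : A} → x ≢ y → y ≢ z → z ≢ x →
                   Injective _≡_ _≡_ (lookup (x ∷ y ∷ z ∷ []))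
triple-injective _   _   _   {0F} {0F} _ = refl
triple-injective _   _   _   {1F} {1F} _ = refl
triple-injective _   _   _   {2F} {2F} _ = refl
triple-injective x≢y _   _   {0F} {1F} e = contradiction e x≢y
triple-injective _   y≢z _   {1F} {2F} e = contradiction e y≢z
triple-injective _   _   z≢x {2F} {0F} e = contradiction e z≢x
triple-injective x≢y _   _   {1F} {0F} e = contradiction (sym e) x≢y
triple-injective _   y≢z _   {2F} {1F} e = contradiction (sym e) y≢z
triple-injective _   _   z≢x {0F} {2F} e = contradiction (sym e) z≢x

parity-suc : ∀ n p → (ℕ.parity n +ℙ p) ⁻¹ ≡ ℕ.parity (ℕ.suc n) +ℙ p
parity-suc ℕ.zero                p = refl
parity-suc (ℕ.suc ℕ.zero)        p = ParityP.⁻¹-involutive p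
parity-suc (ℕ.suc (ℕ.suc n))     p = parity-suc n p

p+q≡q⇒p≡0ℙ : ∀ {p q} → p +ℙ q ≡ q → p ≡ 0ℙ
p+q≡q⇒p≡0ℙ {0ℙ}     _ = refl
p+q≡q⇒p≡0ℙ {1ℙ} {q} e = contradiction (sym e) (ParityP.p≢p⁻¹ q)

inject₁-fromℕ< : ∀ {m n} .(m<n : m < n) .(m<1+n : m < ℕ.suc n) → inject₁ (fromℕ< m<n) ≡ fromℕ< m<1+n
inject₁-fromℕ< {m} m<n m<1+n = FinP.toℕ-injective (begin
  toℕ (inject₁ (fromℕ< m<n))  ≡⟨ FinP.toℕ-inject₁ (fromℕ< m<n) ⟩
  toℕ (fromℕ< m<n)            ≡⟨ FinP.toℕ-fromℕ< m<n ⟩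
  m                           ≡⟨ FinP.toℕ-fromℕ< m<1+n ⟨
  toℕ (fromℕ< m<1+n)          ∎)
  where open ≡-Reasoning

remQuot-injective : ∀ {m} n → Injective _≡_ _≡_ (remQuot {m} n)
remQuot-injective {m} n {i} {j} e = begin
  i                                  ≡⟨ FinP.combine-remQuot {m} n i ⟨
  uncurry combine (remQuot {m} n i)  ≡⟨ cong (uncurry combine) e ⟩
  uncurry combine (remQuot {m} n j)  ≡⟨ FinP.combine-remQuot {m} n j ⟩
  j                                  ∎
  where open ≡-Reasoning

module TannerGraph {R C : Set} (M : R → C → Set) where

  private
    V : Set
    V = TannerVertex R C

    _~_ : V → V → Set
    _~_ = TannerAdj M

  side : V → Parity
  side (inj₁ _) = 0ℙ
  side (inj₂ _) = 1ℙ

  side-flips : ∀ {x y} → x ~ y → side y ≡ side x ⁻¹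
  side-flips {inj₁ _} {inj₂ _} _  = refl
  side-flips {inj₂ _} {inj₁ _} _  = refl
  side-flips {inj₁ _} {inj₁ _} ()
  side-flips {inj₂ _} {inj₂ _} ()

  walk-side : ∀ {k} {f : Fin (3 ℕ.+ k) → V} → (∀ i → f (inject₁ i) ~ f (suc i)) →
              ∀ n (n< : n < 3 ℕ.+ k) → side (f (fromℕ< n<)) ≡ ℕ.parity n +ℙ side (f zero)
  walk-side step ℕ.zero    _  = refl
  walk-side {k} {f} step (ℕ.suc n) n< = begin
    side (f (suc j))                      ≡⟨ side-flips (step j) ⟩
    side (f (inject₁ j)) ⁻¹               ≡⟨ cong (λ i → side (f i) ⁻¹) (inject₁-fromℕ< _ n<3+k) ⟩
    side (f (fromℕ< n<3+k)) ⁻¹            ≡⟨ cong _⁻¹ (walk-side {f = f} step n n<3+k) ⟩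
    (ℕ.parity n +ℙ side (f zero)) ⁻¹      ≡⟨ parity-suc n (side (f zero)) ⟩
    ℕ.parity (ℕ.suc n) +ℙ side (f zero)   ∎
    where
    open ≡-Reasoning
    j : Fin (2 ℕ.+ k)
    j = fromℕ< (ℕ.s<s⁻¹ n<)
    n<3+k : n < 3 ℕ.+ k
    n<3+k = ℕP.<-trans (ℕP.n<1+n n) n<

  cycle-length-even : ∀ {k f} → IsCycle _~_ k f → ℕ.parity (3 ℕ.+ k) ≡ 0ℙ
  cycle-length-even {k} {f} (_ , step , close) = p+q≡q⇒p≡0ℙ (begin
    ℕ.parity (3 ℕ.+ k) +ℙ side (f zero)         ≡⟨ parity-suc (2 ℕ.+ k) (side (f zero)) ⟨
    (ℕ.parity (2 ℕ.+ k) +ℙ side (f zero)) ⁻¹    ≡⟨ cong _⁻¹ (walk-side {f = f} step (2 ℕ.+ k) ℕP.≤-refl) ⟨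
    side (f (fromℕ< ℕP.≤-refl)) ⁻¹              ≡⟨ cong (λ i → side (f i) ⁻¹) (FinP.fromℕ-def (2 ℕ.+ k)) ⟨
    side (f (fromℕ (2 ℕ.+ k))) ⁻¹               ≡⟨ side-flips close ⟨
    side (f zero)                               ∎)
    where open ≡-Reasoning

  record Rectangle : Set where
    constructor rectangle
    field
      r₁ r₂ : R
      c₁ c₂ : C
      r₁≢r₂ : r₁ ≢ r₂
      c₁≢c₂ : c₁ ≢ c₂
      r₁c₁ : M r₁ c₁
      r₁c₂ : M r₁ c₂
      r₂c₁ : M r₂ c₁
      r₂c₂ : M r₂ c₂

  4-cycle⇒rectangle : ∀ {f} → IsCycle _~_ 1 f → Rectangle
  4-cycle⇒rectangle {f} (f-injective , step , close) =
    square (step 0F) (step 1F) (step 2F) close (distinct λ ()) (distinct λ ())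
    where
    distinct : ∀ {i j} → i ≢ j → f i ≢ f j
    distinct = contraInjective {f = f} _≡_ f-injective
    square : ∀ {w₀ w₁ w₂ w₃} → w₀ ~ w₁ → w₁ ~ w₂ → w₂ ~ w₃ → w₃ ~ w₀ → w₀ ≢ w₂ → w₁ ≢ w₃ → Rectangle
    square {inj₁ c₁} {inj₂ r₁} {inj₁ c₂} {inj₂ r₂} e₁₁ e₁₂ e₂₂ e₂₁ c≢ r≢ =
      rectangle r₁ r₂ c₁ c₂ (r≢ ∘ cong inj₂) (c≢ ∘ cong inj₁) e₁₁ e₁₂ e₂₁ e₂₂
    square {inj₂ r₁} {inj₁ c₁} {inj₂ r₂} {inj₁ c₂} e₁₁ e₂₁ e₂₂ e₁₂ r≢ c≢ =
      rectangle r₁ r₂ c₁ c₂ (r≢ ∘ cong inj₂) (c≢ ∘ cong inj₁) e₁₁ e₁₂ e₂₁ e₂₂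
    square {inj₁ _} {inj₁ _} ()
    square {inj₂ _} {inj₂ _} ()
    square {_} {inj₁ _} {inj₁ _} _ ()
    square {_} {inj₂ _} {inj₂ _} _ ()
    square {_} {_} {inj₁ _} {inj₁ _} _ _ ()
    square {_} {_} {inj₂ _} {inj₂ _} _ _ ()

  record Hexagon : Set where
    constructor hexagon
    field
      r₁ r₂ r₃ : R
      c₁ c₂ c₃ : C
      r₁≢r₂ : r₁ ≢ r₂
      r₂≢r₃ : r₂ ≢ r₃
      r₃≢r₁ : r₃ ≢ r₁
      c₁≢c₂ : c₁ ≢ c₂
      c₂≢c₃ : c₂ ≢ c₃
      c₃≢c₁ : c₃ ≢ c₁
      r₁c₁ : M r₁ c₁
      r₁c₂ : M r₁ c₂
      r₂c₂ : M r₂ c₂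
      r₂c₃ : M r₂ c₃
      r₃c₃ : M r₃ c₃
      r₃c₁ : M r₃ c₁

  6-cycle⇒hexagon : ∀ {f} → IsCycle _~_ 3 f → Hexagon
  6-cycle⇒hexagon {f} (f-injective , step , close) =
    around (step 0F) (step 1F) (step 2F) (step 3F) (step 4F) close
      (distinct λ ()) (distinct λ ()) (distinct λ ()) (distinct λ ()) (distinct λ ()) (distinct λ ())
    where
    distinct : ∀ {i j} → i ≢ j → f i ≢ f j
    distinct = contraInjective {f = f} _≡_ f-injective
    around : ∀ {w₀ w₁ w₂ w₃ w₄ w₅} →
      w₀ ~ w₁ → w₁ ~ w₂ → w₂ ~ w₃ → w₃ ~ w₄ → w₄ ~ w₅ → w₅ ~ w₀ →
      w₀ ≢ w₂ → w₂ ≢ w₄ → w₄ ≢ w₀ → w₁ ≢ w₃ → w₃ ≢ w₅ → w₅ ≢ w₁ → Hexagon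
    around {inj₁ c₁} {inj₂ r₁} {inj₁ c₂} {inj₂ r₂} {inj₁ c₃} {inj₂ r₃}
      e₁₁ e₁₂ e₂₂ e₂₃ e₃₃ e₃₁ c₁≢c₂ c₂≢c₃ c₃≢c₁ r₁≢r₂ r₂≢r₃ r₃≢r₁ =
      hexagon r₁ r₂ r₃ c₁ c₂ c₃ (r₁≢r₂ ∘ cong inj₂) (r₂≢r₃ ∘ cong inj₂) (r₃≢r₁ ∘ cong inj₂)
        (c₁≢c₂ ∘ cong inj₁) (c₂≢c₃ ∘ cong inj₁) (c₃≢c₁ ∘ cong inj₁) e₁₁ e₁₂ e₂₂ e₂₃ e₃₃ e₃₁
    around {inj₂ r₃} {inj₁ c₁} {inj₂ r₁} {inj₁ c₂} {inj₂ r₂} {inj₁ c₃}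
      e₃₁ e₁₁ e₁₂ e₂₂ e₂₃ e₃₃ r₃≢r₁ r₁≢r₂ r₂≢r₃ c₁≢c₂ c₂≢c₃ c₃≢c₁ =
      hexagon r₁ r₂ r₃ c₁ c₂ c₃ (r₁≢r₂ ∘ cong inj₂) (r₂≢r₃ ∘ cong inj₂) (r₃≢r₁ ∘ cong inj₂)
        (c₁≢c₂ ∘ cong inj₁) (c₂≢c₃ ∘ cong inj₁) (c₃≢c₁ ∘ cong inj₁) e₁₁ e₁₂ e₂₂ e₂₃ e₃₃ e₃₁
    around {inj₁ _} {inj₁ _} ()
    around {inj₂ _} {inj₂ _} ()
    around {_} {inj₁ _} {inj₁ _} _ ()
    around {_} {inj₂ _} {inj₂ _} _ ()
    around {_} {_} {inj₁ _} {inj₁ _} _ _ ()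
    around {_} {_} {inj₂ _} {inj₂ _} _ _ ()
    around {_} {_} {_} {inj₁ _} {inj₁ _} _ _ _ ()
    around {_} {_} {_} {inj₂ _} {inj₂ _} _ _ _ ()
    around {_} {_} {_} {_} {inj₁ _} {inj₁ _} _ _ _ _ ()
    around {_} {_} {_} {_} {inj₂ _} {inj₂ _} _ _ _ _ ()

  hexagon⇒6-cycle : Hexagon → Σ (Fin 6 → V) (IsCycle _~_ 3)
  hexagon⇒6-cycle
    (hexagon r₁ r₂ r₃ c₁ c₂ c₃ r₁≢r₂ r₂≢r₃ r₃≢r₁ c₁≢c₂ c₂≢c₃ c₃≢c₁ e₁₁ e₁₂ e₂₂ e₂₃ e₃₃ e₃₁) =
    vertex ∘ remQuot 2 , remQuot-injective 2 ∘ vertex-injective , step , e₃₁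
    where
    -- remQuot 2 i = (i / 2 , i mod 2): even positions carry the columns, odd positions the rows
    vertex : Fin 3 × Fin 2 → V
    vertex (j , 0F) = inj₁ (lookup (c₁ ∷ c₂ ∷ c₃ ∷ []) j)
    vertex (j , 1F) = inj₂ (lookup (r₁ ∷ r₂ ∷ r₃ ∷ []) j)
    vertex-injective : Injective _≡_ _≡_ vertex
    vertex-injective {_ , 0F} {_ , 0F} = cong (_, 0F) ∘ triple-injective c₁≢c₂ c₂≢c₃ c₃≢c₁ ∘ inj₁-injective
    vertex-injective {_ , 1F} {_ , 1F} = cong (_, 1F) ∘ triple-injective r₁≢r₂ r₂≢r₃ r₃≢r₁ ∘ inj₂-injective
    vertex-injective {_ , 0F} {_ , 1F} ()
    vertex-injective {_ , 1F} {_ , 0F} ()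
    step : ∀ i → vertex (remQuot 2 (inject₁ i)) ~ vertex (remQuot 2 (suc i))
    step 0F = e₁₁
    step 1F = e₁₂
    step 2F = e₂₂
    step 3F = e₂₃
    step 4F = e₃₃

hexagonSum : ℤ → ℤ → ℤ → ℤ → ℤ → ℤ → ℤ
hexagonSum x₁ x₂ x₃ y₁ y₂ y₃ = x₁ * (y₂ - y₁) + x₂ * (y₃ - y₂) + x₃ * (y₁ - y₃)
-- INLINE lets the ring solver see through hexagonSum.
{-# INLINE hexagonSum #-}

hexagonSum-progression : ∀ x₀ d t₁ t₂ t₃ {x₁ x₂ x₃} →
  x₁ ≡ x₀ + t₁ * d → x₂ ≡ x₀ + t₂ * d → x₃ ≡ x₀ + t₃ * d →
  ∀ y₁ y₂ y₃ → hexagonSum x₁ x₂ x₃ y₁ y₂ y₃ ≡ d * hexagonSum t₁ t₂ t₃ y₁ y₂ y₃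
hexagonSum-progression x₀ d t₁ t₂ t₃ refl refl refl = identity x₀ d t₁ t₂ t₃
  where
  identity : ∀ x₀ d t₁ t₂ t₃ y₁ y₂ y₃ →
    hexagonSum (x₀ + t₁ * d) (x₀ + t₂ * d) (x₀ + t₃ * d) y₁ y₂ y₃ ≡ d * hexagonSum t₁ t₂ t₃ y₁ y₂ y₃
  identity = solve-∀

hexagonSum-012 : ∀ x y z → hexagonSum (+ 0) (+ 1) (+ 2) x y z ≡ - ((y + z) - + 2 * x)
hexagonSum-012 = solve-∀

hexagonSum-021 : ∀ x y z → hexagonSum (+ 0) (+ 2) (+ 1) x y z ≡ (x + z) - + 2 * y
hexagonSum-021 = solve-∀

hexagonSum-102 : ∀ x y z → hexagonSum (+ 1) (+ 0) (+ 2) x y z ≡ (x + y) - + 2 * z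
hexagonSum-102 = solve-∀

hexagonSum-120 : ∀ x y z → hexagonSum (+ 1) (+ 2) (+ 0) x y z ≡ - ((x + y) - + 2 * z)
hexagonSum-120 = solve-∀

hexagonSum-201 : ∀ x y z → hexagonSum (+ 2) (+ 0) (+ 1) x y z ≡ - ((x + z) - + 2 * y)
hexagonSum-201 = solve-∀

hexagonSum-210 : ∀ x y z → hexagonSum (+ 2) (+ 1) (+ 0) x y z ≡ (y + z) - + 2 * x
hexagonSum-210 = solve-∀

permuted-hexagonSum-∣⇒average : ∀ {n} {t₁ t₂ t₃ : Fin 3} → t₁ ≢ t₂ → t₂ ≢ t₃ → t₃ ≢ t₁ → ∀ x y z →
  + n ∣ℤ hexagonSum (+ toℕ t₁) (+ toℕ t₂) (+ toℕ t₃) x y z →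
  y + z ≡ + 2 * x [mod n ] ⊎ x + z ≡ + 2 * y [mod n ] ⊎ x + y ≡ + 2 * z [mod n ]
permuted-hexagonSum-∣⇒average {t₁ = 0F} {0F} t₁≢t₂ _ _ _ _ _ _ = contradiction refl t₁≢t₂
permuted-hexagonSum-∣⇒average {t₁ = 1F} {1F} t₁≢t₂ _ _ _ _ _ _ = contradiction refl t₁≢t₂
permuted-hexagonSum-∣⇒average {t₁ = 2F} {2F} t₁≢t₂ _ _ _ _ _ _ = contradiction refl t₁≢t₂
permuted-hexagonSum-∣⇒average {t₂ = 0F} {0F} _ t₂≢t₃ _ _ _ _ _ = contradiction refl t₂≢t₃
permuted-hexagonSum-∣⇒average {t₂ = 1F} {1F} _ t₂≢t₃ _ _ _ _ _ = contradiction refl t₂≢t₃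
permuted-hexagonSum-∣⇒average {t₂ = 2F} {2F} _ t₂≢t₃ _ _ _ _ _ = contradiction refl t₂≢t₃
permuted-hexagonSum-∣⇒average {t₁ = 0F} {_} {0F} _ _ t₃≢t₁ _ _ _ _ = contradiction refl t₃≢t₁
permuted-hexagonSum-∣⇒average {t₁ = 1F} {_} {1F} _ _ t₃≢t₁ _ _ _ _ = contradiction refl t₃≢t₁
permuted-hexagonSum-∣⇒average {t₁ = 2F} {_} {2F} _ _ t₃≢t₁ _ _ _ _ = contradiction refl t₃≢t₁
permuted-hexagonSum-∣⇒average {t₁ = 0F} {1F} {2F} _ _ _ x y z n∣ =
  inj₁ (ℤ∣.∣⇒∣ᵤ (∣-neg (subst (_ ∣ℤ_) (hexagonSum-012 x y z) n∣)))
permuted-hexagonSum-∣⇒average {t₁ = 0F} {2F} {1F} _ _ _ x y z n∣ =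
  inj₂ (inj₁ (ℤ∣.∣⇒∣ᵤ (subst (_ ∣ℤ_) (hexagonSum-021 x y z) n∣)))
permuted-hexagonSum-∣⇒average {t₁ = 1F} {0F} {2F} _ _ _ x y z n∣ =
  inj₂ (inj₂ (ℤ∣.∣⇒∣ᵤ (subst (_ ∣ℤ_) (hexagonSum-102 x y z) n∣)))
permuted-hexagonSum-∣⇒average {t₁ = 1F} {2F} {0F} _ _ _ x y z n∣ =
  inj₂ (inj₂ (ℤ∣.∣⇒∣ᵤ (∣-neg (subst (_ ∣ℤ_) (hexagonSum-120 x y z) n∣))))
permuted-hexagonSum-∣⇒average {t₁ = 2F} {0F} {1F} _ _ _ x y z n∣ =
  inj₂ (inj₁ (ℤ∣.∣⇒∣ᵤ (∣-neg (subst (_ ∣ℤ_) (hexagonSum-201 x y z) n∣))))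
permuted-hexagonSum-∣⇒average {t₁ = 2F} {1F} {0F} _ _ _ x y z n∣ =
  inj₁ (ℤ∣.∣⇒∣ᵤ (subst (_ ∣ℤ_) (hexagonSum-210 x y z) n∣))

module ArrayCode (q s : ℕ) {r m : ℕ} (a : Fin r → ℕ) (lab : Fin m → ℕ) where

  open TannerGraph (AEntry q s r a m lab)

  private
    Entry : Fin r × Fin q → Fin m × Fin q → Set
    Entry = AEntry q s r a m lab

  shift : Fin r → Fin m → ℤ
  shift i k = + s * (+ a i * + lab k)

  offset : Fin r × Fin q → Fin m × Fin q → ℤ
  offset (i , u) (k , v) = + toℕ v - (+ toℕ u + shift i k)

  entry⇒∣ : ∀ {row col} → Entry row col → + q ∣ℤ offset row col
  entry⇒∣ {i , u} {k , v} =
    subst (λ x → + q ∣ℤ + toℕ v - (+ toℕ u + + s * x)) (ℤP.pos-* (a i) (lab k)) ∘ ℤ∣.∣ᵤ⇒∣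

  ∣⇒entry : ∀ {row col} → + q ∣ℤ offset row col → Entry row col
  ∣⇒entry {i , u} {k , v} =
    ℤ∣.∣⇒∣ᵤ ∘ subst (λ x → + q ∣ℤ + toℕ v - (+ toℕ u + + s * x)) (sym (ℤP.pos-* (a i) (lab k)))

  common-column⇒distinct-block-rows : ∀ {row row′ col} → Entry row col → Entry row′ col → row ≢ row′ →
                                      proj₁ row ≢ proj₁ row′
  common-column⇒distinct-block-rows {i , u} {_ , u′} {k , v} e e′ row≢row′ refl =
    row≢row′ (cong (i ,_) (∣[i-j]⇒i≡j (subst (+ q ∣ℤ_) (identity (+ toℕ v) (+ toℕ u) (+ toℕ u′) (shift i k))
      (ℤ∣.∣m∣n⇒∣m-n (entry⇒∣ e′) (entry⇒∣ e)))))
    where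
    identity : ∀ v u u′ x → (v - (u′ + x)) - (v - (u + x)) ≡ u - u′
    identity = solve-∀

  common-row⇒distinct-block-columns : ∀ {row col col′} → Entry row col → Entry row col′ → col ≢ col′ →
                                      proj₁ col ≢ proj₁ col′
  common-row⇒distinct-block-columns {i , u} {k , v} {_ , v′} e e′ col≢col′ refl =
    col≢col′ (cong (k ,_) (∣[i-j]⇒i≡j (subst (+ q ∣ℤ_) (identity (+ toℕ v) (+ toℕ v′) (+ toℕ u) (shift i k))
      (ℤ∣.∣m∣n⇒∣m-n (entry⇒∣ e) (entry⇒∣ e′)))))
    where
    identity : ∀ v v′ u x → (v - (u + x)) - (v′ - (u + x)) ≡ v - v′
    identity = solve-∀

  rectangle-∣ : ∀ {i₁ u₁ i₂ u₂ k₁ v₁ k₂ v₂} →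
    Entry (i₁ , u₁) (k₁ , v₁) → Entry (i₁ , u₁) (k₂ , v₂) →
    Entry (i₂ , u₂) (k₁ , v₁) → Entry (i₂ , u₂) (k₂ , v₂) →
    + q ∣ℤ + s * ((+ a i₁ - + a i₂) * (+ lab k₁ - + lab k₂))
  rectangle-∣ {i₁} {u₁} {i₂} {u₂} {k₁} {v₁} {k₂} {v₂} e₁₁ e₁₂ e₂₁ e₂₂ =
    subst (+ q ∣ℤ_)
      (identity (+ toℕ u₁) (+ toℕ u₂) (+ toℕ v₁) (+ toℕ v₂) (+ s) (+ a i₁) (+ a i₂) (+ lab k₁) (+ lab k₂))
      (ℤ∣.∣m∣n⇒∣m-n (ℤ∣.∣m∣n⇒∣m+n (ℤ∣.∣m∣n⇒∣m-n (entry⇒∣ e₁₂) (entry⇒∣ e₁₁)) (entry⇒∣ e₂₁)) (entry⇒∣ e₂₂))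
    where
    identity : ∀ u₁ u₂ v₁ v₂ s A₁ A₂ L₁ L₂ →
        (v₂ - (u₁ + s * (A₁ * L₂))) - (v₁ - (u₁ + s * (A₁ * L₁)))
      + (v₁ - (u₂ + s * (A₂ * L₁))) - (v₂ - (u₂ + s * (A₂ * L₂)))
      ≡ s * ((A₁ - A₂) * (L₁ - L₂))
    identity = solve-∀

  no-rectangle : Prime q → ¬ + q ∣ℤ + s →
                 (∀ i → a i < q) → Injective _≡_ _≡_ a →
                 (∀ k → lab k < q) → Injective _≡_ _≡_ lab → ¬ Rectangle
  no-rectangle q-prime q∤s a<q a-injective lab<q lab-injective
    (rectangle (i₁ , _) (i₂ , _) (k₁ , _) (k₂ , _) r₁≢r₂ c₁≢c₂ e₁₁ e₁₂ e₂₁ e₂₂) =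
    Sum.[ common-column⇒distinct-block-rows e₁₁ e₂₁ r₁≢r₂ ∘ a-injective ∘ ∣[+m-+n]⇒m≡n (a<q i₁) (a<q i₂)
        , common-row⇒distinct-block-columns e₁₁ e₁₂ c₁≢c₂ ∘ lab-injective ∘ ∣[+m-+n]⇒m≡n (lab<q k₁) (lab<q k₂)
        ] (prime-∣-* _ _ q-prime (prime-∣-cancelˡ (+ s) _ q-prime q∤s (rectangle-∣ e₁₁ e₁₂ e₂₁ e₂₂)))

  hexagon-closes⇔∣ : ∀ {i₁ u₁ i₂ u₂ i₃ u₃ k₁ v₁ k₂ v₂ k₃ v₃} →
    Entry (i₁ , u₁) (k₁ , v₁) → Entry (i₁ , u₁) (k₂ , v₂) → Entry (i₂ , u₂) (k₂ , v₂) →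
    Entry (i₂ , u₂) (k₃ , v₃) → Entry (i₃ , u₃) (k₃ , v₃) →
    (Entry (i₃ , u₃) (k₁ , v₁) ⇔
     + q ∣ℤ + s * hexagonSum (+ a i₁) (+ a i₂) (+ a i₃) (+ lab k₁) (+ lab k₂) (+ lab k₃))
  hexagon-closes⇔∣ {i₁} {u₁} {i₂} {u₂} {i₃} {u₃} {k₁} {v₁} {k₂} {v₂} {k₃} {v₃} e₁₁ e₁₂ e₂₂ e₂₃ e₃₃ = mk⇔
    (λ e₃₁ → subst (+ q ∣ℤ_) around (ℤ∣.∣m∣n⇒∣m-n q∣path (entry⇒∣ e₃₁)))
    (λ q∣sH → ∣⇒entry (subst (+ q ∣ℤ_) (cancel path closing)
                (ℤ∣.∣m∣n⇒∣m-n q∣path (subst (+ q ∣ℤ_) (sym around) q∣sH))))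
    where
    path closing : ℤ
    path = offset (i₁ , u₁) (k₁ , v₁) - offset (i₁ , u₁) (k₂ , v₂) + offset (i₂ , u₂) (k₂ , v₂)
         - offset (i₂ , u₂) (k₃ , v₃) + offset (i₃ , u₃) (k₃ , v₃)
    closing = offset (i₃ , u₃) (k₁ , v₁)
    q∣path : + q ∣ℤ path
    q∣path = ℤ∣.∣m∣n⇒∣m+n (ℤ∣.∣m∣n⇒∣m-n (ℤ∣.∣m∣n⇒∣m+n (ℤ∣.∣m∣n⇒∣m-n
      (entry⇒∣ e₁₁) (entry⇒∣ e₁₂)) (entry⇒∣ e₂₂)) (entry⇒∣ e₂₃)) (entry⇒∣ e₃₃)
    identity : ∀ u₁ u₂ u₃ v₁ v₂ v₃ s A₁ A₂ A₃ L₁ L₂ L₃ →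
        (v₁ - (u₁ + s * (A₁ * L₁))) - (v₂ - (u₁ + s * (A₁ * L₂))) + (v₂ - (u₂ + s * (A₂ * L₂)))
      - (v₃ - (u₂ + s * (A₂ * L₃))) + (v₃ - (u₃ + s * (A₃ * L₃))) - (v₁ - (u₃ + s * (A₃ * L₁)))
      ≡ s * hexagonSum A₁ A₂ A₃ L₁ L₂ L₃
    identity = solve-∀
    around : path - closing ≡ + s * hexagonSum (+ a i₁) (+ a i₂) (+ a i₃) (+ lab k₁) (+ lab k₂) (+ lab k₃)
    around = identity (+ toℕ u₁) (+ toℕ u₂) (+ toℕ u₃) (+ toℕ v₁) (+ toℕ v₂) (+ toℕ v₃)
                      (+ s) (+ a i₁) (+ a i₂) (+ a i₃) (+ lab k₁) (+ lab k₂) (+ lab k₃)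
    cancel : ∀ x y → x - (x - y) ≡ y
    cancel = solve-∀

  module _ .{{_ : ℕ.NonZero q}} where

    neighbour-column : ∀ i u k → Entry (i , u) (k , reduce (+ toℕ u + shift i k))
    neighbour-column i u k = ∣⇒entry (reduce-∣ (+ toℕ u + shift i k))

    neighbour-row : ∀ i k v → Entry (i , reduce (+ toℕ v - shift i k)) (k , v)
    neighbour-row i k v = ∣⇒entry (subst (+ q ∣ℤ_) (identity (+ toℕ (reduce x)) (+ toℕ v) (shift i k))
      (ℤ∣.∣m⇒∣-m (reduce-∣ x)))
      where
      x : ℤ
      x = + toℕ v - shift i k
      identity : ∀ u v x → - (u - (v - x)) ≡ v - (u + x)
      identity = solve-∀

    ∣⇒hexagon : ∀ {i₁ i₂ i₃ k₁ k₂ k₃} → i₁ ≢ i₂ → i₂ ≢ i₃ → i₃ ≢ i₁ → k₁ ≢ k₂ → k₂ ≢ k₃ → k₃ ≢ k₁ →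
      + q ∣ℤ + s * hexagonSum (+ a i₁) (+ a i₂) (+ a i₃) (+ lab k₁) (+ lab k₂) (+ lab k₃) → Hexagon
    ∣⇒hexagon {i₁} {i₂} {i₃} {k₁} {k₂} {k₃} i₁≢i₂ i₂≢i₃ i₃≢i₁ k₁≢k₂ k₂≢k₃ k₃≢k₁ q∣sH =
      hexagon (i₁ , u₁) (i₂ , u₂) (i₃ , u₃) (k₁ , v₁) (k₂ , v₂) (k₃ , v₃)
        (i₁≢i₂ ∘ cong proj₁) (i₂≢i₃ ∘ cong proj₁) (i₃≢i₁ ∘ cong proj₁)
        (k₁≢k₂ ∘ cong proj₁) (k₂≢k₃ ∘ cong proj₁) (k₃≢k₁ ∘ cong proj₁)
        e₁₁ e₁₂ e₂₂ e₂₃ e₃₃ (Equivalence.from (hexagon-closes⇔∣ e₁₁ e₁₂ e₂₂ e₂₃ e₃₃) q∣sH)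
      where
      -- five edges can always be laid from u₁; the divisibility closes the sixth
      u₁ v₁ v₂ u₂ v₃ u₃ : Fin q
      u₁ = reduce (+ 0)
      v₁ = reduce (+ toℕ u₁ + shift i₁ k₁)
      v₂ = reduce (+ toℕ u₁ + shift i₁ k₂)
      u₂ = reduce (+ toℕ v₂ - shift i₂ k₂)
      v₃ = reduce (+ toℕ u₂ + shift i₂ k₃)
      u₃ = reduce (+ toℕ v₃ - shift i₃ k₃)
      e₁₁ : Entry (i₁ , u₁) (k₁ , v₁)
      e₁₁ = neighbour-column i₁ u₁ k₁
      e₁₂ : Entry (i₁ , u₁) (k₂ , v₂)
      e₁₂ = neighbour-column i₁ u₁ k₂
      e₂₂ : Entry (i₂ , u₂) (k₂ , v₂)
      e₂₂ = neighbour-row i₂ k₂ v₂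
      e₂₃ : Entry (i₂ , u₂) (k₃ , v₃)
      e₂₃ = neighbour-column i₂ u₂ k₃
      e₃₃ : Entry (i₃ , u₃) (k₃ , v₃)
      e₃₃ = neighbour-row i₃ k₃ v₃

module ProperArrayCode
    (q : ℕ) (q-prime : Prime q) (q-odd : ¬ (2 ∣ q))
    (s : ℕ) (1≤s : 1 ≤ s) (s<q : s < q)
    (a : Fin 3 → ℕ) (a<q : ∀ i → a i < q) (a-injective : Injective _≡_ _≡_ a)
    (a₀ : ℕ) (d : ℤ) (a-progression : ∀ i → + a i ≡ + a₀ + + toℕ i * d)
    (m : ℕ) (lab : Fin m → ℕ) (lab<q : ∀ k → lab k < q) (lab-injective : Injective _≡_ _≡_ lab)
    where

  open TannerGraph (AEntry q s 3 a m lab)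
  open ArrayCode q s a lab

  instance
    q≢0 : ℕ.NonZero q
    q≢0 = prime⇒nonZero q-prime

  q∤s : ¬ + q ∣ℤ + s
  q∤s = 0<n<p⇒p∤n 1≤s s<q

  q∤2 : ¬ + q ∣ℤ + 2
  q∤2 = 0<n<p⇒p∤n ℕ.z<s (odd-prime⇒2<p q-prime q-odd)

  q∤d : ¬ + q ∣ℤ d
  q∤d q∣d =
    contradiction (a-injective (∣[+m-+n]⇒m≡n (a<q 1F) (a<q 0F) (subst (+ q ∣ℤ_) (sym a₁-a₀≡d) q∣d))) λ ()
    where
    identity : ∀ x d → (x + + 1 * d) - (x + + 0 * d) ≡ d
    identity = solve-∀
    a₁-a₀≡d : + a 1F - + a 0F ≡ d
    a₁-a₀≡d rewrite a-progression 0F | a-progression 1F = identity (+ a₀) d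

  hexagonSum-exponents : ∀ i₁ i₂ i₃ y₁ y₂ y₃ →
    hexagonSum (+ a i₁) (+ a i₂) (+ a i₃) y₁ y₂ y₃
      ≡ d * hexagonSum (+ toℕ i₁) (+ toℕ i₂) (+ toℕ i₃) y₁ y₂ y₃
  hexagonSum-exponents i₁ i₂ i₃ = hexagonSum-progression (+ a₀) d (+ toℕ i₁) (+ toℕ i₂) (+ toℕ i₃)
    (a-progression i₁) (a-progression i₂) (a-progression i₃)

  no-hexagon : NonAveraging q m lab → ¬ Hexagon
  no-hexagon (_ , _ , averaging)
    (hexagon (i₁ , _) (i₂ , _) (i₃ , _) (k₁ , _) (k₂ , _) (k₃ , _)
             r₁≢r₂ r₂≢r₃ r₃≢r₁ c₁≢c₂ c₂≢c₃ c₃≢c₁ e₁₁ e₁₂ e₂₂ e₂₃ e₃₃ e₃₁) =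
    Sum.[ common-row⇒distinct-block-columns e₂₂ e₂₃ c₂≢c₃ ∘ proj₁ ∘ averaging k₂ k₃ k₁
        , Sum.[ common-row⇒distinct-block-columns e₃₁ e₃₃ (c₃≢c₁ ∘ sym) ∘ proj₁ ∘ averaging k₁ k₃ k₂
              , common-row⇒distinct-block-columns e₁₁ e₁₂ c₁≢c₂ ∘ proj₁ ∘ averaging k₁ k₂ k₃
              ]
        ]
    (permuted-hexagonSum-∣⇒average
      (common-column⇒distinct-block-rows e₁₂ e₂₂ r₁≢r₂)
      (common-column⇒distinct-block-rows e₂₃ e₃₃ r₂≢r₃)
      (common-column⇒distinct-block-rows e₃₁ e₁₁ r₃≢r₁)
      (+ lab k₁) (+ lab k₂) (+ lab k₃) q∣H)
    where
    q∣H : + q ∣ℤ hexagonSum (+ toℕ i₁) (+ toℕ i₂) (+ toℕ i₃) (+ lab k₁) (+ lab k₂) (+ lab k₃)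
    q∣H = prime-∣-cancelˡ d _ q-prime q∤d
      (subst (+ q ∣ℤ_) (hexagonSum-exponents i₁ i₂ i₃ (+ lab k₁) (+ lab k₂) (+ lab k₃))
        (prime-∣-cancelˡ (+ s) _ q-prime q∤s (Equivalence.to (hexagon-closes⇔∣ e₁₁ e₁₂ e₂₂ e₂₃ e₃₃) e₃₁)))

  nonAveraging⇒girth≥8 : NonAveraging q m lab → GirthAtLeast (TannerAdj (AEntry q s 3 a m lab)) 8
  nonAveraging⇒girth≥8 _  0 _ cycle = contradiction (cycle-length-even cycle) λ ()
  nonAveraging⇒girth≥8 _  1 _ cycle =
    ⊥-elim (no-rectangle q-prime q∤s a<q a-injective lab<q lab-injective (4-cycle⇒rectangle cycle))
  nonAveraging⇒girth≥8 _  2 _ cycle = contradiction (cycle-length-even cycle) λ ()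
  nonAveraging⇒girth≥8 na 3 _ cycle = ⊥-elim (no-hexagon na (6-cycle⇒hexagon cycle))
  nonAveraging⇒girth≥8 _  4 _ cycle = contradiction (cycle-length-even cycle) λ ()
  nonAveraging⇒girth≥8 _  (ℕ.suc (ℕ.suc (ℕ.suc (ℕ.suc (ℕ.suc k))))) _ _ = ℕP.m≤m+n 8 k

  girth≥8⇒no-hexagon : GirthAtLeast (TannerAdj (AEntry q s 3 a m lab)) 8 → ¬ Hexagon
  girth≥8⇒no-hexagon girth = from-no (8 ℕP.≤? 6) ∘ uncurry (girth 3) ∘ hexagon⇒6-cycle

  averaging-triple⇒hexagon : ∀ {i j k} → i ≢ j → k ≢ i → k ≢ j →
    + lab i + + lab j ≡ + 2 * + lab k [mod q ] → Hexagon
  averaging-triple⇒hexagon {i} {j} {k} i≢j k≢i k≢j avg =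
    ∣⇒hexagon {0F} {1F} {2F} {k} {i} {j} (λ ()) (λ ()) (λ ()) k≢i i≢j (k≢j ∘ sym)
      (ℤ∣.∣n⇒∣m*n (+ s) (subst (+ q ∣ℤ_) (sym (hexagonSum-exponents 0F 1F 2F (+ lab k) (+ lab i) (+ lab j)))
        (ℤ∣.∣n⇒∣m*n d (subst (+ q ∣ℤ_) (sym (hexagonSum-012 (+ lab k) (+ lab i) (+ lab j)))
          (ℤ∣.∣m⇒∣-m (ℤ∣.∣ᵤ⇒∣ avg))))))

  doubled-average : ∀ {i k} → + lab i + + lab i ≡ + 2 * + lab k [mod q ] → i ≡ k
  doubled-average {i} {k} avg = lab-injective (∣[+m-+n]⇒m≡n (lab<q i) (lab<q k)
    (prime-∣-cancelˡ (+ 2) _ q-prime q∤2 (subst (+ q ∣ℤ_) (identity (+ lab i) (+ lab k)) (ℤ∣.∣ᵤ⇒∣ avg))))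
    where
    identity : ∀ x y → (x + x) - + 2 * y ≡ + 2 * (x - y)
    identity = solve-∀

  endpoint-average : ∀ {i j} → + lab i + + lab j ≡ + 2 * + lab j [mod q ] → i ≡ j
  endpoint-average {i} {j} avg = lab-injective (∣[+m-+n]⇒m≡n (lab<q i) (lab<q j)
    (subst (+ q ∣ℤ_) (identity (+ lab i) (+ lab j)) (ℤ∣.∣ᵤ⇒∣ avg)))
    where
    identity : ∀ x y → (x + y) - + 2 * y ≡ x - y
    identity = solve-∀

  girth≥8⇒nonAveraging : GirthAtLeast (TannerAdj (AEntry q s 3 a m lab)) 8 → NonAveraging q m lab
  girth≥8⇒nonAveraging girth = lab-injective , lab<q , averaging
    where
    averaging : ∀ i j k → + lab i + + lab j ≡ + 2 * + lab k [mod q ] → i ≡ j × j ≡ k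
    averaging i j k avg with i FinP.≟ j | k FinP.≟ i | k FinP.≟ j
    ... | yes refl | _        | _        = refl , doubled-average avg
    ... | no i≢j   | yes refl | _        = contradiction (sym (endpoint-average avg′)) i≢j
      where
      avg′ : + lab j + + lab i ≡ + 2 * + lab i [mod q ]
      avg′ = subst (_≡ + 2 * + lab i [mod q ]) (ℤP.+-comm (+ lab i) (+ lab j)) avg
    ... | no i≢j   | no _     | yes refl = contradiction (endpoint-average avg) i≢j
    ... | no i≢j   | no k≢i   | no k≢j   =
      contradiction (averaging-triple⇒hexagon i≢j k≢i k≢j avg) (girth≥8⇒no-hexagon girth)

corollary1 : (q : ℕ) → Prime q → ¬ (2 ∣ q) →
    (s : ℕ) → 1 ≤ s → s < q →
    (a : Fin 3 → ℕ) → IsPAC q 3 a →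
    (m : ℕ) (lab : Fin m → ℕ) → (∀ k → lab k < q) →
    (∀ k k′ → toℕ k < toℕ k′ → lab k < lab k′) →
    (GirthAtLeast (TannerAdj (AEntry q s 3 a m lab)) 8 ⇔ NonAveraging q m lab)
corollary1 q q-prime q-odd s 1≤s s<q a (a<q , a-injective , a₀ , d , _ , a-progression)
           m lab lab<q lab-increasing =
  mk⇔ girth≥8⇒nonAveraging nonAveraging⇒girth≥8
  where
  open ProperArrayCode q q-prime q-odd s 1≤s s<q a a<q a-injective a₀ d a-progression
                       m lab lab<q (increasing⇒injective lab-increasing)
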